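{- \[ \liminf_{n\to \infty} \frac{\phi^*(\phi^*(n))}{\log n \log \log n}> 0. \]
   Context: $\phi^*$ is the unitary Euler function: the multiplicative function with $\phi^*(1)=1$ and, if $n=p_1^{a_1}\cdots p_r^{a_r}$ is the prime factorization of $n>1$, $\phi^*(n)=(p_1^{a_1}-1)\cdots(p_r^{a_r}-1)$. -}

module Defs where

open import Data.Nat using (ℕ; zero; suc; _*_; _∸_; _/_)
open import Data.Nat.Divisibility using (_∣?_)
open import Data.Nat.Primality using (prime?)
open import Data.List using (List; map; filter; upTo)
open import Data.Nat.ListAction using (product)
open import Data.Bool using (Bool; true; false; if_then_else_)
open import Relation.Nullary using (does)
open import Relation.Nullary.Decidable using (_×-dec_)

-- primePowerPart p n fuel : the largest power of p dividing n (for p ≥ 2,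
-- n ≥ 1 and fuel ≥ n), i.e. p ^ (p-adic valuation of n).
primePowerPart : ℕ → ℕ → ℕ → ℕ
primePowerPart p           n zero       = 1
primePowerPart zero        n (suc f)    = 1
primePowerPart (suc zero)  n (suc f)    = 1
primePowerPart p@(suc (suc q)) zero (suc f) = 1
primePowerPart p@(suc (suc q)) n@(suc m) (suc f) =
  if does (p ∣? n) then p * primePowerPart p (n / p) f else 1

primeDivisors : ℕ → List ℕ
primeDivisors n = filter (λ p → prime? p ×-dec p ∣? n) (upTo (suc n))

-- unitary Euler function: φ*(n) = ∏_{p^a ∥ n} (p^a − 1), with φ*(1) = 1
-- (φ*(0) is irrelevant; with this definition it is 1).
φ* : ℕ → ℕ
φ* zero = 1
φ* n@(suc _) = product (map (λ p → primePowerPart p n n ∸ 1) (primeDivisors n))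

-- Every prime power q = p^a exactly dividing n satisfies q ≤ (q − 1)², except q = 2,
-- which satisfies q = 2 (q − 1)²; hence n ≤ 2 φ*(n)². Applying this to n and to φ*(n)
-- gives n ≤ 2 (2 M²)² ≤ (2M)⁴ with M = φ*(φ*(n)), so φ*(φ*(n)) grows at least like
-- n^(1/4). Writing L = ⌊log₂ n⌋, the inequality 2^L ≤ (2M)⁴ forces L² ≤ 128 M, and
-- L · ⌊log₂ L⌋ ≤ L².
module Submission where

open import Data.Bool using (if_then_else_)
open import Data.List using (List; []; _∷_; map; upTo)
open import Data.List.Membership.Propositional using (_∈_)
open import Data.List.Membership.Propositional.Properties using (∈-map⁺; ∈-filter⁺; ∈-upTo⁺)
open import Data.List.Relation.Unary.All using (All; []; _∷_)
import Data.List.Relation.Unary.All as All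
open import Data.List.Relation.Unary.All.Properties using (all-filter; map⁺)
open import Data.List.Relation.Unary.AllPairs using ([]; _∷_)
open import Data.List.Relation.Unary.Unique.Propositional using (Unique)
import Data.List.Relation.Unary.Unique.Propositional.Properties as Unique
open import Data.Nat
open import Data.Nat.Coprimality using (Coprime; coprime-divisor; prime⇒coprime)
import Data.Nat.Coprimality as Coprime
open import Data.Nat.Divisibility
open import Data.Nat.DivMod
open import Data.Nat.Induction using (<-rec)
open import Data.Nat.ListAction using (product)
open import Data.Nat.ListAction.Properties using (∈⇒∣product; product≢0)
open import Data.Nat.Logarithm
open import Data.Nat.Primality
open import Data.Nat.Primality.Factorisation using (PrimeFactorisation; factorise)
open import Data.Nat.Properties
open import Algebra.Properties.CommutativeSemigroup *-commutativeSemigroup using (x∙yz≈y∙xz)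
open import Data.Nat.Tactic.RingSolver using (solve-∀)
open import Data.Product using (_×_; _,_; ∃-syntax)
open import Function using (_∘_)
open import Relation.Binary.Definitions using (tri<; tri≈; tri>)
open import Relation.Binary.PropositionalEquality
open import Relation.Nullary using (yes; no; contradiction)
open import Relation.Nullary.Decidable using (dec-true; dec-false; _×-dec_)

open import Defs

primePowerPart-∣ : ∀ {q m} f → let p = 2+ q; n = suc m in
                   p ∣ n → primePowerPart p n (suc f) ≡ p * primePowerPart p (n / p) f
primePowerPart-∣ {q} {m} f p∣n =
  cong (λ b → if b then 2+ q * primePowerPart (2+ q) (suc m / 2+ q) f else 1)
       (dec-true (_ ∣? _) p∣n)

primePowerPart-∤ : ∀ {q m} f → let p = 2+ q; n = suc m in
                   p ∤ n → primePowerPart p n (suc f) ≡ 1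
primePowerPart-∤ {q} {m} f p∤n =
  cong (λ b → if b then 2+ q * primePowerPart (2+ q) (suc m / 2+ q) f else 1)
       (dec-false (_ ∣? _) p∤n)

primePowerPart>0 : ∀ p n f → primePowerPart p n f > 0
primePowerPart>0 p n zero = z<s
primePowerPart>0 zero n (suc f) = z<s
primePowerPart>0 (suc zero) n (suc f) = z<s
primePowerPart>0 (2+ q) zero (suc f) = z<s
primePowerPart>0 p@(2+ q) n@(suc m) (suc f) with p ∣? n
... | yes p∣n rewrite primePowerPart-∣ f p∣n =
  *-mono-≤ {1} {p} z<s (primePowerPart>0 p (n / p) f)
... | no p∤n  rewrite primePowerPart-∤ f p∤n = z<s

^∣⇒^∣primePowerPart : ∀ {p n} f b → .{{_ : NonTrivial p}} → .{{_ : NonZero n}} →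
                      n ≤ f → p ^ b ∣ n → p ^ b ∣ primePowerPart p n f
^∣⇒^∣primePowerPart f zero _ _ = 1∣ _
^∣⇒^∣primePowerPart {2+ _} {suc _} zero (suc _) () _
^∣⇒^∣primePowerPart {p@(2+ _)} {n@(suc _)} (suc f) (suc b) n≤f pᵇ⁺¹∣n =
  subst (p ^ suc b ∣_) (sym (primePowerPart-∣ f p∣n))
    (*-monoʳ-∣ p (^∣⇒^∣primePowerPart f b {{_}} {{n/p≢0}} n/p≤f pᵇ∣n/p))
  where
  p∣n : p ∣ n
  p∣n = m*n∣⇒m∣ p (p ^ b) pᵇ⁺¹∣n
  n/p≢0 : NonZero (n / p)
  n/p≢0 = >-nonZero (m≥n⇒m/n>0 (∣⇒≤ p∣n))
  n/p≤f : n / p ≤ f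
  n/p≤f = <⇒≤pred (<-≤-trans (m/n<m n p (nonTrivial⇒n>1 p)) n≤f)
  pᵇ∣n/p : p ^ b ∣ n / p
  pᵇ∣n/p = m*n∣o⇒n∣o/m p (p ^ b) pᵇ⁺¹∣n

coprime-^-divisor : ∀ {r q x} b .{{_ : NonZero r}} → Coprime r q → r ^ b ∣ q * x → r ^ b ∣ x
coprime-^-divisor zero _ _ = 1∣ _
coprime-^-divisor {r} {q} (suc b) r⊥q rᵇ⁺¹∣qx
  with coprime-divisor r⊥q (m*n∣⇒m∣ r (r ^ b) rᵇ⁺¹∣qx)
... | divides x′ refl =
  subst (r ^ suc b ∣_) (*-comm r x′) (*-monoʳ-∣ r (coprime-^-divisor b r⊥q rᵇ∣qx′))
  where
  q[x′r]≡r[qx′] : q * (x′ * r) ≡ r * (q * x′)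
  q[x′r]≡r[qx′] = trans (cong (q *_) (*-comm x′ r)) (x∙yz≈y∙xz q r x′)
  rᵇ∣qx′ : r ^ b ∣ q * x′
  rᵇ∣qx′ = *-cancelˡ-∣ r (subst (r * r ^ b ∣_) q[x′r]≡r[qx′] rᵇ⁺¹∣qx)

≢⇒coprime : ∀ {p q} → Prime p → Prime q → p ≢ q → Coprime p q
≢⇒coprime {p} {q} pp pq p≢q with <-cmp p q
... | tri< p<q _ _ = Coprime.sym (prime⇒coprime pq {{prime⇒nonZero pp}} p<q)
... | tri≈ _ p≡q _ = contradiction p≡q p≢q
... | tri> _ _ q<p = prime⇒coprime pp {{prime⇒nonZero pq}} q<p

product-primes∣ : ∀ {ps d} → All Prime ps →
                  (∀ r b → Prime r → r ^ b ∣ product ps → r ^ b ∣ d) → product ps ∣ d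
product-primes∣ [] _ = 1∣ _
product-primes∣ {q ∷ ps} {d} (pq ∷ pps) ^∣⇒^∣d =
  subst (q * product ps ∣_) (sym d≡qd′) (*-monoʳ-∣ q (product-primes∣ pps ^∣⇒^∣d′))
  where
  instance _ = prime⇒nonZero pq
  q∣d : q ∣ d
  q∣d = subst (_∣ d) (*-identityʳ q) (^∣⇒^∣d q 1 pq (*-monoʳ-∣ q (1∣ _)))
  d′ : ℕ
  d′ = quotient q∣d
  d≡qd′ : d ≡ q * d′
  d≡qd′ = m∣n⇒n≡m*quotient q∣d
  ^∣⇒^∣d′ : ∀ r b → Prime r → r ^ b ∣ product ps → r ^ b ∣ d′
  ^∣⇒^∣d′ r b pr rᵇ∣ps with r ≟ q
  ... | yes refl =
    *-cancelˡ-∣ q (subst (q ^ suc b ∣_) d≡qd′ (^∣⇒^∣d q (suc b) pq (*-monoʳ-∣ q rᵇ∣ps)))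
  ... | no r≢q   = coprime-^-divisor b {{prime⇒nonZero pr}} (≢⇒coprime pr pq r≢q)
                     (subst (r ^ b ∣_) d≡qd′ (^∣⇒^∣d r b pr (∣n⇒∣m*n q rᵇ∣ps)))

primePowers∣⇒∣ : ∀ {n d} .{{_ : NonZero n}} →
                 (∀ r b → Prime r → r ^ b ∣ n → r ^ b ∣ d) → n ∣ d
primePowers∣⇒∣ {n} {d} ^∣⇒^∣d = subst (_∣ d) (sym isFactorisation)
  (product-primes∣ factorsPrime λ r b pr → ^∣⇒^∣d r b pr ∘ subst (r ^ b ∣_) (sym isFactorisation))
  where open PrimeFactorisation (factorise n)

_-part_ : ℕ → ℕ → ℕ
p -part n = primePowerPart p n n

∈-primeDivisors : ∀ {p n} .{{_ : NonZero n}} → Prime p → p ∣ n → p ∈ primeDivisors n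
∈-primeDivisors pp p∣n =
  ∈-filter⁺ (λ p → prime? p ×-dec p ∣? _) (∈-upTo⁺ (s≤s (∣⇒≤ p∣n))) (pp , p∣n)

primeDivisors-prime∣ : ∀ n → All (λ p → Prime p × p ∣ n) (primeDivisors n)
primeDivisors-prime∣ n = all-filter (λ p → prime? p ×-dec p ∣? n) (upTo (suc n))

primeDivisors-unique : ∀ n → Unique (primeDivisors n)
primeDivisors-unique n = Unique.filter⁺ (λ p → prime? p ×-dec p ∣? n) (Unique.upTo⁺ (suc n))

∣product-parts : ∀ n .{{_ : NonZero n}} → n ∣ product (map (_-part n) (primeDivisors n))
∣product-parts n = primePowers∣⇒∣ rᵇ∣n⇒rᵇ∣parts
  where
  rᵇ∣n⇒rᵇ∣parts : ∀ r b → Prime r → r ^ b ∣ n →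
                  r ^ b ∣ product (map (_-part n) (primeDivisors n))
  rᵇ∣n⇒rᵇ∣parts r zero    _  _     = 1∣ _
  rᵇ∣n⇒rᵇ∣parts r (suc b) pr rᵇ∣n =
    ∣-trans (^∣⇒^∣primePowerPart n (suc b) {{prime⇒nonTrivial pr}} ≤-refl rᵇ∣n)
            (∈⇒∣product (∈-map⁺ (_-part n) (∈-primeDivisors pr (m*n∣⇒m∣ r (r ^ b) rᵇ∣n))))

p≤p-part : ∀ {p n} .{{_ : NonZero n}} → Prime p → p ∣ n → p ≤ p -part n
p≤p-part {p} {n} pp p∣n = ∣⇒≤ {{>-nonZero (primePowerPart>0 p n n)}}
  (subst (_∣ p -part n) (^-identityʳ p)
    (^∣⇒^∣primePowerPart n 1 {{prime⇒nonTrivial pp}} ≤-refl (subst (_∣ n) (sym (^-identityʳ p)) p∣n)))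

twoIfTwo : ℕ → ℕ
twoIfTwo 2 = 2
twoIfTwo _ = 1

twoIfTwo-≢2 : ∀ {p} → 2 ≢ p → twoIfTwo p ≡ 1
twoIfTwo-≢2 {0} _ = refl
twoIfTwo-≢2 {1} _ = refl
twoIfTwo-≢2 {2} 2≢2 = contradiction refl 2≢2
twoIfTwo-≢2 {suc (suc (suc _))} _ = refl

product-twoIfTwo-≢2 : ∀ {ps} → All (2 ≢_) ps → product (map twoIfTwo ps) ≡ 1
product-twoIfTwo-≢2 [] = refl
product-twoIfTwo-≢2 (2≢p ∷ 2∉ps) rewrite twoIfTwo-≢2 2≢p | product-twoIfTwo-≢2 2∉ps = refl

product-twoIfTwo≤2 : ∀ {ps} → Unique ps → product (map twoIfTwo ps) ≤ 2
product-twoIfTwo≤2 [] = s≤s z≤n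
product-twoIfTwo≤2 {p ∷ ps} (p∉ps ∷ ps-unique) with 2 ≟ p
... | yes refl rewrite product-twoIfTwo-≢2 p∉ps = ≤-refl
... | no 2≢p   rewrite twoIfTwo-≢2 2≢p =
  ≤-trans (≤-reflexive (*-identityˡ _)) (product-twoIfTwo≤2 ps-unique)

n≤2*[n∸1]² : ∀ {n} → 2 ≤ n → n ≤ 2 * ((n ∸ 1) * (n ∸ 1))
n≤2*[n∸1]² (s≤s (s≤s {n = k} z≤n)) =
  +-mono-≤ {1} (s≤s z≤n) (≤-trans (m≤m*n (suc k) (suc k)) (m≤m+n _ 0))

n≤[n∸1]² : ∀ {n} → 3 ≤ n → n ≤ (n ∸ 1) * (n ∸ 1)
n≤[n∸1]² (s≤s (s≤s (s≤s {n = k} z≤n))) = m<m+n (2 + k) z<s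

x≤twoIfTwo*[x∸1]² : ∀ {p x} → Prime p → p ≤ x → x ≤ twoIfTwo p * ((x ∸ 1) * (x ∸ 1))
x≤twoIfTwo*[x∸1]² {p} pp p≤x with 2 ≟ p
... | yes refl = n≤2*[n∸1]² p≤x
... | no 2≢p rewrite twoIfTwo-≢2 2≢p =
  m≤n⇒m≤o*n 1 (n≤[n∸1]² (≤-trans 3≤p p≤x))
  where
  3≤p : 3 ≤ p
  3≤p = ≤∧≢⇒< (nonTrivial⇒n>1 p {{prime⇒nonTrivial pp}}) 2≢p

product-≤-*-square : ∀ {f c g : ℕ → ℕ} xs → All (λ x → f x ≤ c x * (g x * g x)) xs →
  product (map f xs) ≤ product (map c xs) * (product (map g xs) * product (map g xs))
product-≤-*-square [] [] = ≤-refl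
product-≤-*-square {f} {c} {g} (x ∷ xs) (fx≤ ∷ fxs≤) = begin
  f x * product (map f xs)              ≤⟨ *-mono-≤ fx≤ (product-≤-*-square xs fxs≤) ⟩
  (c x * (g x * g x)) * (C * (G * G))   ≡⟨ interchange (c x) C (g x) G ⟩
  (c x * C) * ((g x * G) * (g x * G))   ∎
  where
  open ≤-Reasoning
  C G : ℕ
  C = product (map c xs)
  G = product (map g xs)
  interchange : ∀ a b s t → (a * (s * s)) * (b * (t * t)) ≡ (a * b) * ((s * t) * (s * t))
  interchange = solve-∀

n≤2*φ*[n]² : ∀ n .{{_ : NonZero n}} → n ≤ 2 * (φ* n * φ* n)
n≤2*φ*[n]² n@(suc _) = begin
  n                                           ≤⟨ ∣⇒≤ {{parts≢0}} (∣product-parts n) ⟩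
  product (map (_-part n) ps)                 ≤⟨ product-≤-*-square ps parts≤ ⟩
  product (map twoIfTwo ps) * (φ* n * φ* n)   ≤⟨ *-monoˡ-≤ _ (product-twoIfTwo≤2 (primeDivisors-unique n)) ⟩
  2 * (φ* n * φ* n)                           ∎
  where
  open ≤-Reasoning
  ps : List ℕ
  ps = primeDivisors n
  parts≢0 : NonZero (product (map (_-part n) ps))
  parts≢0 = product≢0 (map⁺ (All.universal (λ p → >-nonZero (primePowerPart>0 p n n)) ps))
  parts≤ : All (λ p → p -part n ≤ twoIfTwo p * ((p -part n ∸ 1) * (p -part n ∸ 1))) ps
  parts≤ = All.map (λ (pp , p∣n) → x≤twoIfTwo*[x∸1]² pp (p≤p-part pp p∣n)) (primeDivisors-prime∣ n)

φ*>0 : ∀ n → φ* n > 0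
φ*>0 zero = z<s
φ*>0 n@(suc _) = n≢0⇒n>0 λ φ*n≡0 →
  contradiction (subst (λ m → n ≤ 2 * (m * m)) φ*n≡0 (n≤2*φ*[n]² n)) λ ()

n<2^n : ∀ n → n < 2 ^ n
n<2^n zero = z<s
n<2^n (suc n) = +-mono-≤ (m^n>0 2 n) (≤-trans (n<2^n n) (m≤m+n (2 ^ n) 0))

⌊log₂n⌋≤n : ∀ n → ⌊log₂ n ⌋ ≤ n
⌊log₂n⌋≤n n = begin
  ⌊log₂ n ⌋       ≤⟨ ⌊log₂⌋-mono-≤ (<⇒≤ (n<2^n n)) ⟩
  ⌊log₂ 2 ^ n ⌋   ≡⟨ ⌊log₂[2^n]⌋≡n n ⟩
  n               ∎
  where open ≤-Reasoning

2^⌊log₂n⌋≤n : ∀ n .{{_ : NonZero n}} → 2 ^ ⌊log₂ n ⌋ ≤ n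
2^⌊log₂n⌋≤n = <-rec (λ n → .{{NonZero n}} → 2 ^ ⌊log₂ n ⌋ ≤ n) step
  where
  step : ∀ n → (∀ {m} → m < n → .{{NonZero m}} → 2 ^ ⌊log₂ m ⌋ ≤ m) →
         .{{NonZero n}} → 2 ^ ⌊log₂ n ⌋ ≤ n
  step 1 _ = ≤-refl
  step n@(suc (suc k)) rec = begin
    2 ^ ⌊log₂ n ⌋                ≡⟨ cong (2 ^_) ⌊log₂n⌋≡1+⌊log₂⌊n/2⌋⌋ ⟩
    2 * 2 ^ ⌊log₂ ⌊ n /2⌋ ⌋      ≤⟨ *-monoʳ-≤ 2 (rec (⌊n/2⌋<n (suc k))) ⟩
    2 * ⌊ n /2⌋                  ≤⟨ +-monoʳ-≤ ⌊ n /2⌋ (≤-trans (≤-reflexive (+-identityʳ _)) (⌊n/2⌋≤⌈n/2⌉ n)) ⟩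
    ⌊ n /2⌋ + ⌈ n /2⌉            ≡⟨ ⌊n/2⌋+⌈n/2⌉≡n n ⟩
    n                            ∎
    where
    open ≤-Reasoning
    ⌊log₂n⌋≡1+⌊log₂⌊n/2⌋⌋ : ⌊log₂ n ⌋ ≡ 1 + ⌊log₂ ⌊ n /2⌋ ⌋
    ⌊log₂n⌋≡1+⌊log₂⌊n/2⌋⌋ = begin-equality
      ⌊log₂ n ⌋                ≡⟨ m+[n∸m]≡n (⌊log₂⌋-mono-≤ {2} {n} (s≤s (s≤s z≤n))) ⟨
      1 + (⌊log₂ n ⌋ ∸ 1)      ≡⟨ cong (1 +_) (⌊log₂⌊n/2⌋⌋≡⌊log₂n⌋∸1 n) ⟨
      1 + ⌊log₂ ⌊ n /2⌋ ⌋      ∎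

^-cancelˡ-≤ : ∀ k .{{_ : NonZero k}} {m n} → m ^ k ≤ n ^ k → m ≤ n
^-cancelˡ-≤ k mᵏ≤nᵏ = ≮⇒≥ λ n<m → <⇒≱ (^-monoˡ-< k n<m) mᵏ≤nᵏ

[1+n]²≤4*2^n : ∀ n → suc n * suc n ≤ 4 * 2 ^ n
[1+n]²≤4*2^n 0 = ≤ᵇ⇒≤ _ _ _
[1+n]²≤4*2^n 1 = ≤ᵇ⇒≤ _ _ _
[1+n]²≤4*2^n 2 = ≤ᵇ⇒≤ _ _ _
[1+n]²≤4*2^n (suc (suc (suc e))) = begin
  (4 + e) * (4 + e)                         ≤⟨ m≤m+n _ (e * e + 4 * e + 2) ⟩
  (4 + e) * (4 + e) + (e * e + 4 * e + 2)   ≡⟨ expand e ⟩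
  2 * ((3 + e) * (3 + e))                   ≤⟨ *-monoʳ-≤ 2 ([1+n]²≤4*2^n (suc (suc e))) ⟩
  2 * (4 * 2 ^ (2 + e))                     ≡⟨ x∙yz≈y∙xz 2 4 (2 ^ (2 + e)) ⟩
  4 * 2 ^ (3 + e)                           ∎
  where
  open ≤-Reasoning
  expand : ∀ e → (4 + e) * (4 + e) + (e * e + 4 * e + 2) ≡ 2 * ((3 + e) * (3 + e))
  expand = solve-∀

2^n≤m⁴⇒n²≤64*m : ∀ {n m} → 2 ^ n ≤ m ^ 4 → n * n ≤ 64 * m
2^n≤m⁴⇒n²≤64*m {n} {m} 2ⁿ≤m⁴ = begin
  n * n                       ≤⟨ *-mono-≤ n≤4[1+a] n≤4[1+a] ⟩
  (suc a * 4) * (suc a * 4)   ≡⟨ regroup (suc a) ⟩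
  16 * (suc a * suc a)        ≤⟨ *-monoʳ-≤ 16 ([1+n]²≤4*2^n a) ⟩
  16 * (4 * 2 ^ a)            ≤⟨ *-monoʳ-≤ 16 (*-monoʳ-≤ 4 2ᵃ≤m) ⟩
  16 * (4 * m)                ≡⟨ *-assoc 16 4 m ⟨
  64 * m                      ∎
  where
  open ≤-Reasoning
  a : ℕ
  a = n / 4
  n≤4[1+a] : n ≤ suc a * 4
  n≤4[1+a] = begin
    n             ≡⟨ m≡m%n+[m/n]*n n 4 ⟩
    n % 4 + a * 4 ≤⟨ +-monoˡ-≤ (a * 4) (m%n≤n n 4) ⟩
    4 + a * 4     ∎
  2ᵃ≤m : 2 ^ a ≤ m
  2ᵃ≤m = ^-cancelˡ-≤ 4 (begin
    (2 ^ a) ^ 4   ≡⟨ ^-*-assoc 2 a 4 ⟩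
    2 ^ (a * 4)   ≤⟨ ^-monoʳ-≤ 2 (m/n*n≤m n 4) ⟩
    2 ^ n         ≤⟨ 2ⁿ≤m⁴ ⟩
    m ^ 4         ∎)
  regroup : ∀ s → (s * 4) * (s * 4) ≡ 16 * (s * s)
  regroup = solve-∀

n≤2m²∧m≤2k²⇒n≤[2k]⁴ : ∀ {n m k} → n ≤ 2 * (m * m) → m ≤ 2 * (k * k) → n ≤ (2 * k) ^ 4
n≤2m²∧m≤2k²⇒n≤[2k]⁴ {n} {m} {k} n≤2m² m≤2k² = begin
  n                                  ≤⟨ n≤2m² ⟩
  2 * (m * m)                        ≤⟨ *-monoʳ-≤ 2 (*-mono-≤ m≤2k² m≤2k²) ⟩
  2 * (2 * (k * k) * (2 * (k * k)))  ≤⟨ *-monoˡ-≤ (2 * (k * k) * (2 * (k * k))) (≤ᵇ⇒≤ 2 4 _) ⟩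
  4 * (2 * (k * k) * (2 * (k * k)))  ≡⟨ expand k ⟩
  (2 * k) ^ 4                        ∎
  where
  open ≤-Reasoning
  -- the right-hand side is (2 * k) ^ 4 unfolded, since solve-∀ does not normalise _^_
  expand : ∀ k → 4 * (2 * (k * k) * (2 * (k * k))) ≡ 2 * k * (2 * k * (2 * k * (2 * k * 1)))
  expand = solve-∀

theorem7 : ∃[ k ] ∃[ N ] ((n : ℕ) → n ≥ N →
             ⌊log₂ n ⌋ * ⌊log₂ ⌊log₂ n ⌋ ⌋ ≤ k * φ* (φ* n))
theorem7 = 128 , 1 , bound
  where
  bound : ∀ n → n ≥ 1 → ⌊log₂ n ⌋ * ⌊log₂ ⌊log₂ n ⌋ ⌋ ≤ 128 * φ* (φ* n)
  bound n n≥1 = begin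
    ⌊log₂ n ⌋ * ⌊log₂ ⌊log₂ n ⌋ ⌋   ≤⟨ *-monoʳ-≤ ⌊log₂ n ⌋ (⌊log₂n⌋≤n ⌊log₂ n ⌋) ⟩
    ⌊log₂ n ⌋ * ⌊log₂ n ⌋           ≤⟨ 2^n≤m⁴⇒n²≤64*m {⌊log₂ n ⌋} {2 * M} 2^⌊log₂n⌋≤[2M]⁴ ⟩
    64 * (2 * M)                   ≡⟨ *-assoc 64 2 M ⟨
    128 * M                        ∎
    where
    open ≤-Reasoning
    instance
      _ = >-nonZero n≥1
      _ = >-nonZero (φ*>0 n)
    M : ℕ
    M = φ* (φ* n)
    2^⌊log₂n⌋≤[2M]⁴ : 2 ^ ⌊log₂ n ⌋ ≤ (2 * M) ^ 4
    2^⌊log₂n⌋≤[2M]⁴ = ≤-trans (2^⌊log₂n⌋≤n n)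
      (n≤2m²∧m≤2k²⇒n≤[2k]⁴ {k = M} (n≤2*φ*[n]² n) (n≤2*φ*[n]² (φ* n)))
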